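{- Let $\mathfrak{K}=(\{a,b\},R,E)$ where $R=\{(a,a),(a,b),(b,b)\}$ and $E=\{a,b\}^2$, and let $\mathfrak{H}=(\{a,b,c\},R,E)$ where $R[a]=\{a,b,c\}$, $R[b]=R[c]=\{b,c\}$, and $E$ is the equivalence relation with classes $\{a,b\}$ and $\{c\}$. Then: (1) $\mathfrak{K}$ validates $\mathsf{MGrz}$ but does not validate $\mathsf{LKur}$; (2) $\mathfrak{H}$ validates $\mathsf{LKur}$ but does not validate $\mathsf{MGrz}$; (3) $\mathsf{MGrz}$ and $\mathsf{LKur}$ are incomparable (neither contains the other).
   Context: $\mathcal{L}_{\Box\forall}$ is the language of classical propositional logic with unary modalities $\Box,\forall$; $\Diamond=\neg\Box\neg$, $\exists=\neg\forall\neg$. $\mathsf{MS4}$ is the smallest set of $\mathcal{L}_{\Box\forall}$-formulas containing all classical tautologies, the $\mathsf{S4}$ axioms for $\Box$, the $\mathsf{S5}$ axioms for $\forall$ and $\Box\forall p\to\forall\Box p$, closed under modus ponens, uniform substitution and necessitation for $\Box$ and $\forall$; $\mathsf{MS4}+\chi$ is the smallest such set also containing $\chi$. $\mathsf{MGrz}=\mathsf{MS4}+(\Box(\Box(p\to\Box p)\to p)\to p)$ and $\mathsf{LKur}=\mathsf{MS4}+(\Box\forall\Diamond\Box p\to\Diamond\forall p)$. A frame $(Y,R,E)$ (with $R$ a quasi-order and $E$ an equivalence relation; $R[x]=\{y:xRy\}$) validates a formula if it is true at every point under every valuation, where $\Box$ is interpreted via $R$ and $\forall$ via $E$ in the standard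 Kripke way; it validates a logic if it validates all its formulas. -}

module Defs where

open import Data.Nat using (ℕ; zero; suc)
open import Data.Fin using (Fin; zero; suc)
open import Data.Bool using (Bool; true; false; _∧_; _∨_; not)
open import Relation.Binary.PropositionalEquality using (_≡_; refl)

infixr 5 _⇒_

data Fm : Set where
  var : ℕ → Fm
  ⊥'  : Fm
  _⇒_ : Fm → Fm → Fm
  □   : Fm → Fm
  A   : Fm → Fm      -- the universal modality ∀

¬' : Fm → Fm
¬' φ = φ ⇒ ⊥'

◇ : Fm → Fm
◇ φ = ¬' (□ (¬' φ))

E' : Fm → Fm
E' φ = ¬' (A (¬' φ))

p q : Fm
p = var 0
q = var 1

-- Classical tautologies: formulas true under every Boolean assignment
-- in which variables and modalized subformulas (□ψ, ∀ψ) are treated as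
-- propositional atoms.

evalP : (Fm → Bool) → Fm → Bool
evalP v (var n) = v (var n)
evalP v ⊥'      = false
evalP v (φ ⇒ ψ) = not (evalP v φ) ∨ evalP v ψ
evalP v (□ φ)   = v (□ φ)
evalP v (A φ)   = v (A φ)

Tautology : Fm → Set
Tautology φ = (v : Fm → Bool) → evalP v φ ≡ true

subst : (ℕ → Fm) → Fm → Fm
subst σ (var n) = σ n
subst σ ⊥'      = ⊥'
subst σ (φ ⇒ ψ) = subst σ φ ⇒ subst σ ψ
subst σ (□ φ)   = □ (subst σ φ)
subst σ (A φ)   = A (subst σ φ)

-- MS4 + χ : the smallest set containing the tautologies, the S4 axioms
-- for □, the S5 axioms for ∀, □∀p → ∀□p and χ, closed under MP,
-- uniform substitution and necessitation for □ and ∀.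
-- (MS4 itself is MS4+ applied to a tautology, e.g. ⊥' ⇒ ⊥'.)

data MS4+ (χ : Fm) : Fm → Set where
  taut   : ∀ {φ} → Tautology φ → MS4+ χ φ
  □K     : MS4+ χ (□ (p ⇒ q) ⇒ (□ p ⇒ □ q))
  □T     : MS4+ χ (□ p ⇒ p)
  □4     : MS4+ χ (□ p ⇒ □ (□ p))
  AK     : MS4+ χ (A (p ⇒ q) ⇒ (A p ⇒ A q))
  AT     : MS4+ χ (A p ⇒ p)
  A4     : MS4+ χ (A p ⇒ A (A p))
  A5     : MS4+ χ (E' p ⇒ A (E' p))
  left   : MS4+ χ (□ (A p) ⇒ A (□ p))
  extra  : MS4+ χ χ
  mp     : ∀ {φ ψ} → MS4+ χ (φ ⇒ ψ) → MS4+ χ φ → MS4+ χ ψ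
  usubst : ∀ {φ} (σ : ℕ → Fm) → MS4+ χ φ → MS4+ χ (subst σ φ)
  nec□   : ∀ {φ} → MS4+ χ φ → MS4+ χ (□ φ)
  necA   : ∀ {φ} → MS4+ χ φ → MS4+ χ (A φ)

grz : Fm
grz = □ (□ (p ⇒ □ p) ⇒ p) ⇒ p

kur : Fm
kur = □ (A (◇ (□ p))) ⇒ ◇ (A p)

MGrz : Fm → Set
MGrz = MS4+ grz

LKur : Fm → Set
LKur = MS4+ kur

record Frame : Set where
  field
    size    : ℕ
    R       : Fin size → Fin size → Bool
    E       : Fin size → Fin size → Bool
    R-refl  : ∀ x → R x x ≡ true
    R-trans : ∀ x y z → R x y ≡ true → R y z ≡ true → R x z ≡ true
    E-refl  : ∀ x → E x x ≡ true
    E-sym   : ∀ x y → E x y ≡ true → E y x ≡ true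
    E-trans : ∀ x y z → E x y ≡ true → E y z ≡ true → E x z ≡ true

every : ∀ {n} → (Fin n → Bool) → Bool
every {zero}  f = true
every {suc n} f = f zero ∧ every (λ i → f (suc i))

module _ (F : Frame) where
  open Frame F

  sat : (ℕ → Fin size → Bool) → Fin size → Fm → Bool
  sat V w (var n) = V n w
  sat V w ⊥'      = false
  sat V w (φ ⇒ ψ) = not (sat V w φ) ∨ sat V w ψ
  sat V w (□ φ)   = every (λ u → not (R w u) ∨ sat V u φ)
  sat V w (A φ)   = every (λ u → not (E w u) ∨ sat V u φ)

  ValidFm : Fm → Set
  ValidFm φ = (V : ℕ → Fin size → Bool) (w : Fin size) → sat V w φ ≡ true

  ValidLogic : (Fm → Set) → Set
  ValidLogic L = ∀ φ → L φ → ValidFm φ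

-- The two frames; points a,b,c are zero, suc zero, suc (suc zero).

RK : Fin 2 → Fin 2 → Bool
RK zero zero = true
RK zero (suc zero) = true
RK (suc zero) zero = false
RK (suc zero) (suc zero) = true

EK : Fin 2 → Fin 2 → Bool
EK zero zero = true
EK zero (suc zero) = true
EK (suc zero) zero = true
EK (suc zero) (suc zero) = true

private
  RK-refl : ∀ x → RK x x ≡ true
  RK-refl zero = refl
  RK-refl (suc zero) = refl
  RK-trans : ∀ x y z → RK x y ≡ true → RK y z ≡ true → RK x z ≡ true
  RK-trans zero zero zero p q = refl
  RK-trans zero zero (suc zero) p q = refl
  RK-trans zero (suc zero) zero p ()
  RK-trans zero (suc zero) (suc zero) p q = refl
  RK-trans (suc zero) zero zero () _
  RK-trans (suc zero) zero (suc zero) () _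
  RK-trans (suc zero) (suc zero) zero p ()
  RK-trans (suc zero) (suc zero) (suc zero) p q = refl
  EK-refl : ∀ x → EK x x ≡ true
  EK-refl zero = refl
  EK-refl (suc zero) = refl
  EK-sym : ∀ x y → EK x y ≡ true → EK y x ≡ true
  EK-sym zero zero p = refl
  EK-sym zero (suc zero) p = refl
  EK-sym (suc zero) zero p = refl
  EK-sym (suc zero) (suc zero) p = refl
  EK-trans : ∀ x y z → EK x y ≡ true → EK y z ≡ true → EK x z ≡ true
  EK-trans zero zero zero p q = refl
  EK-trans zero zero (suc zero) p q = refl
  EK-trans zero (suc zero) zero p q = refl
  EK-trans zero (suc zero) (suc zero) p q = refl
  EK-trans (suc zero) zero zero p q = refl
  EK-trans (suc zero) zero (suc zero) p q = refl
  EK-trans (suc zero) (suc zero) zero p q = refl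
  EK-trans (suc zero) (suc zero) (suc zero) p q = refl

RH : Fin 3 → Fin 3 → Bool
RH zero zero = true
RH zero (suc zero) = true
RH zero (suc (suc zero)) = true
RH (suc zero) zero = false
RH (suc zero) (suc zero) = true
RH (suc zero) (suc (suc zero)) = true
RH (suc (suc zero)) zero = false
RH (suc (suc zero)) (suc zero) = true
RH (suc (suc zero)) (suc (suc zero)) = true

EH : Fin 3 → Fin 3 → Bool
EH zero zero = true
EH zero (suc zero) = true
EH zero (suc (suc zero)) = false
EH (suc zero) zero = true
EH (suc zero) (suc zero) = true
EH (suc zero) (suc (suc zero)) = false
EH (suc (suc zero)) zero = false
EH (suc (suc zero)) (suc zero) = false
EH (suc (suc zero)) (suc (suc zero)) = true

private
  RH-refl : ∀ x → RH x x ≡ true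
  RH-refl zero = refl
  RH-refl (suc zero) = refl
  RH-refl (suc (suc zero)) = refl
  RH-trans : ∀ x y z → RH x y ≡ true → RH y z ≡ true → RH x z ≡ true
  RH-trans zero zero zero p q = refl
  RH-trans zero zero (suc zero) p q = refl
  RH-trans zero zero (suc (suc zero)) p q = refl
  RH-trans zero (suc zero) zero p ()
  RH-trans zero (suc zero) (suc zero) p q = refl
  RH-trans zero (suc zero) (suc (suc zero)) p q = refl
  RH-trans zero (suc (suc zero)) zero p ()
  RH-trans zero (suc (suc zero)) (suc zero) p q = refl
  RH-trans zero (suc (suc zero)) (suc (suc zero)) p q = refl
  RH-trans (suc zero) zero zero () _
  RH-trans (suc zero) zero (suc zero) () _
  RH-trans (suc zero) zero (suc (suc zero)) () _
  RH-trans (suc zero) (suc zero) zero p ()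
  RH-trans (suc zero) (suc zero) (suc zero) p q = refl
  RH-trans (suc zero) (suc zero) (suc (suc zero)) p q = refl
  RH-trans (suc zero) (suc (suc zero)) zero p ()
  RH-trans (suc zero) (suc (suc zero)) (suc zero) p q = refl
  RH-trans (suc zero) (suc (suc zero)) (suc (suc zero)) p q = refl
  RH-trans (suc (suc zero)) zero zero () _
  RH-trans (suc (suc zero)) zero (suc zero) () _
  RH-trans (suc (suc zero)) zero (suc (suc zero)) () _
  RH-trans (suc (suc zero)) (suc zero) zero p ()
  RH-trans (suc (suc zero)) (suc zero) (suc zero) p q = refl
  RH-trans (suc (suc zero)) (suc zero) (suc (suc zero)) p q = refl
  RH-trans (suc (suc zero)) (suc (suc zero)) zero p ()
  RH-trans (suc (suc zero)) (suc (suc zero)) (suc zero) p q = refl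
  RH-trans (suc (suc zero)) (suc (suc zero)) (suc (suc zero)) p q = refl
  EH-refl : ∀ x → EH x x ≡ true
  EH-refl zero = refl
  EH-refl (suc zero) = refl
  EH-refl (suc (suc zero)) = refl
  EH-sym : ∀ x y → EH x y ≡ true → EH y x ≡ true
  EH-sym zero zero p = refl
  EH-sym zero (suc zero) p = refl
  EH-sym zero (suc (suc zero)) ()
  EH-sym (suc zero) zero p = refl
  EH-sym (suc zero) (suc zero) p = refl
  EH-sym (suc zero) (suc (suc zero)) ()
  EH-sym (suc (suc zero)) zero ()
  EH-sym (suc (suc zero)) (suc zero) ()
  EH-sym (suc (suc zero)) (suc (suc zero)) p = refl
  EH-trans : ∀ x y z → EH x y ≡ true → EH y z ≡ true → EH x z ≡ true
  EH-trans zero zero zero p q = refl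
  EH-trans zero zero (suc zero) p q = refl
  EH-trans zero zero (suc (suc zero)) p ()
  EH-trans zero (suc zero) zero p q = refl
  EH-trans zero (suc zero) (suc zero) p q = refl
  EH-trans zero (suc zero) (suc (suc zero)) p ()
  EH-trans zero (suc (suc zero)) zero () _
  EH-trans zero (suc (suc zero)) (suc zero) () _
  EH-trans zero (suc (suc zero)) (suc (suc zero)) () _
  EH-trans (suc zero) zero zero p q = refl
  EH-trans (suc zero) zero (suc zero) p q = refl
  EH-trans (suc zero) zero (suc (suc zero)) p ()
  EH-trans (suc zero) (suc zero) zero p q = refl
  EH-trans (suc zero) (suc zero) (suc zero) p q = refl
  EH-trans (suc zero) (suc zero) (suc (suc zero)) p ()
  EH-trans (suc zero) (suc (suc zero)) zero () _
  EH-trans (suc zero) (suc (suc zero)) (suc zero) () _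
  EH-trans (suc zero) (suc (suc zero)) (suc (suc zero)) () _
  EH-trans (suc (suc zero)) zero zero () _
  EH-trans (suc (suc zero)) zero (suc zero) () _
  EH-trans (suc (suc zero)) zero (suc (suc zero)) () _
  EH-trans (suc (suc zero)) (suc zero) zero () _
  EH-trans (suc (suc zero)) (suc zero) (suc zero) () _
  EH-trans (suc (suc zero)) (suc zero) (suc (suc zero)) () _
  EH-trans (suc (suc zero)) (suc (suc zero)) zero p ()
  EH-trans (suc (suc zero)) (suc (suc zero)) (suc zero) p ()
  EH-trans (suc (suc zero)) (suc (suc zero)) (suc (suc zero)) p q = refl

𝔎 : Frame
𝔎 = record { size = 2 ; R = RK ; E = EK ; R-refl = RK-refl ; R-trans = RK-trans
           ; E-refl = EK-refl ; E-sym = EK-sym ; E-trans = EK-trans }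

ℌ : Frame
ℌ = record { size = 3 ; R = RH ; E = EH ; R-refl = RH-refl ; R-trans = RH-trans
           ; E-refl = EH-refl ; E-sym = EH-sym ; E-trans = EH-trans }

-- Both frames satisfy the MS4 commutation condition E ∘ R ⊆ R ∘ E, so each
-- validates MS4 together with any extra axiom it validates. 𝔎 is a finite
-- partial order and validates Grz, but with p true only at its top point b the
-- premise of Kur holds at a while ∀p fails. ℌ validates Kur, but its proper
-- cluster {b, c} refutes Grz. A frame validating one logic but not the other
-- shows that the first logic is not contained in the second. Grz and Kur
-- involve only p, so their validity on the finite frames is checked by running
-- through all valuations of p.
module Submission where

open import Defs
open import Data.Nat using (ℕ; zero; suc)
open import Data.Fin using (Fin; zero; suc)
open import Data.Bool using (Bool; true; false; _∧_; _∨_; not)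
open import Data.Product using (_×_; _,_; proj₁; proj₂; ∃-syntax)
open import Data.Vec.Functional using ([]; _∷_; tail)
open import Relation.Nullary using (¬_)
open import Relation.Binary.PropositionalEquality
  using (_≡_; _≗_; refl; sym; trans; cong; cong₂)

∧-true : ∀ {x y} → x ∧ y ≡ true → x ≡ true × y ≡ true
∧-true {true} h = refl , h

⇒ᵇ-intro : ∀ {x y} → (x ≡ true → y ≡ true) → not x ∨ y ≡ true
⇒ᵇ-intro {false} _ = refl
⇒ᵇ-intro {true}  h = h refl

⇒ᵇ-elim : ∀ {x y} → not x ∨ y ≡ true → x ≡ true → y ≡ true
⇒ᵇ-elim h refl = h

every-intro : ∀ {n} {f : Fin n → Bool} → (∀ i → f i ≡ true) → every f ≡ true
every-intro {zero}  h = refl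
every-intro {suc n} h rewrite h zero = every-intro (λ i → h (suc i))

every-elim : ∀ {n} {f : Fin n → Bool} → every f ≡ true → ∀ i → f i ≡ true
every-elim h zero    = proj₁ (∧-true h)
every-elim h (suc i) = every-elim (proj₂ (∧-true h)) i

every-cong : ∀ {n} {f g : Fin n → Bool} → f ≗ g → every f ≡ every g
every-cong {zero}  f≗g = refl
every-cong {suc n} f≗g = cong₂ _∧_ (f≗g zero) (every-cong (λ i → f≗g (suc i)))

∷-cong : ∀ {n} {x : Bool} {f g : Fin n → Bool} → f ≗ g → (x ∷ f) ≗ (x ∷ g)
∷-cong f≗g zero    = refl
∷-cong f≗g (suc i) = f≗g i

head∷tail : ∀ {n} (f : Fin (suc n) → Bool) → f ≗ (f zero ∷ tail f)
head∷tail f zero    = refl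
head∷tail f (suc i) = refl

everyPredicate : ∀ n → ((Fin n → Bool) → Bool) → Bool
everyPredicate zero    k = k []
everyPredicate (suc n) k = everyPredicate n (λ f → k (true ∷ f) ∧ k (false ∷ f))

everyPredicate-elim : ∀ n {k : (Fin n → Bool) → Bool} →
                      (∀ {f g} → f ≗ g → k f ≡ k g) →
                      everyPredicate n k ≡ true → ∀ f → k f ≡ true
everyPredicate-elim zero    k-cong h f = trans (k-cong (λ ())) h
everyPredicate-elim (suc n) {k} k-cong h f =
  trans (k-cong (head∷tail f)) (by-head (f zero) (both-heads (tail f)))
  where
  both-heads : ∀ g → k (true ∷ g) ∧ k (false ∷ g) ≡ true
  both-heads = everyPredicate-elim n
    (λ f≗g → cong₂ _∧_ (k-cong (∷-cong f≗g)) (k-cong (∷-cong f≗g))) h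
  by-head : ∀ x {g} → k (true ∷ g) ∧ k (false ∷ g) ≡ true → k (x ∷ g) ≡ true
  by-head true  both = proj₁ (∧-true both)
  by-head false both = proj₂ (∧-true both)

module FrameSemantics (F : Frame) where
  open Frame F

  Valuation : Set
  Valuation = ℕ → Fin size → Bool

  Commutes : Set
  Commutes = ∀ x y z → E x y ≡ true → R y z ≡ true → ∃[ u ] (R x u ≡ true × E u z ≡ true)

  -- φ is explicit: it cannot be recovered from the unfolded truth condition.
  module Rules (V : Valuation) {w : Fin size} (φ : Fm) where

    □-intro : (∀ u → R w u ≡ true → sat F V u φ ≡ true) → sat F V w (□ φ) ≡ true
    □-intro h = every-intro (λ u → ⇒ᵇ-intro (h u))

    □-elim : sat F V w (□ φ) ≡ true → ∀ u → R w u ≡ true → sat F V u φ ≡ true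
    □-elim h u = ⇒ᵇ-elim (every-elim h u)

    A-intro : (∀ u → E w u ≡ true → sat F V u φ ≡ true) → sat F V w (A φ) ≡ true
    A-intro h = every-intro (λ u → ⇒ᵇ-intro (h u))

    A-elim : sat F V w (A φ) ≡ true → ∀ u → E w u ≡ true → sat F V u φ ≡ true
    A-elim h u = ⇒ᵇ-elim (every-elim h u)

  □K-valid : ValidFm F (□ (p ⇒ q) ⇒ (□ p ⇒ □ q))
  □K-valid V w = ⇒ᵇ-intro λ □p⇒q → ⇒ᵇ-intro λ □p →
    □-intro q λ u wRu → ⇒ᵇ-elim (□-elim (p ⇒ q) □p⇒q u wRu) (□-elim p □p u wRu)
    where open Rules V

  □T-valid : ValidFm F (□ p ⇒ p)
  □T-valid V w = ⇒ᵇ-intro λ □p → □-elim p □p w (R-refl w)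
    where open Rules V

  □4-valid : ValidFm F (□ p ⇒ □ (□ p))
  □4-valid V w = ⇒ᵇ-intro λ □p →
    □-intro (□ p) λ u wRu → □-intro p λ v uRv → □-elim p □p v (R-trans w u v wRu uRv)
    where open Rules V

  AK-valid : ValidFm F (A (p ⇒ q) ⇒ (A p ⇒ A q))
  AK-valid V w = ⇒ᵇ-intro λ Ap⇒q → ⇒ᵇ-intro λ Ap →
    A-intro q λ u wEu → ⇒ᵇ-elim (A-elim (p ⇒ q) Ap⇒q u wEu) (A-elim p Ap u wEu)
    where open Rules V

  AT-valid : ValidFm F (A p ⇒ p)
  AT-valid V w = ⇒ᵇ-intro λ Ap → A-elim p Ap w (E-refl w)
    where open Rules V

  A4-valid : ValidFm F (A p ⇒ A (A p))
  A4-valid V w = ⇒ᵇ-intro λ Ap →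
    A-intro (A p) λ u wEu → A-intro p λ v uEv → A-elim p Ap v (E-trans w u v wEu uEv)
    where open Rules V

  A5-valid : ValidFm F (E' p ⇒ A (E' p))
  A5-valid V w = ⇒ᵇ-intro λ ∃p → A-intro (E' p) λ v wEv → ⇒ᵇ-intro λ A¬p-at-v →
    ⇒ᵇ-elim ∃p (A-intro (¬' p) λ u wEu →
      A-elim (¬' p) A¬p-at-v u (E-trans v w u (E-sym w v wEv) wEu))
    where open Rules V

  left-valid : Commutes → ValidFm F (□ (A p) ⇒ A (□ p))
  left-valid commutes V w = ⇒ᵇ-intro λ □Ap → A-intro (□ p) λ v wEv → □-intro p λ z vRz →
    let (u , wRu , uEz) = commutes w v z wEv vRz in A-elim p (□-elim (A p) □Ap u wRu) z uEz
    where open Rules V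

  evalP-sat : ∀ V w φ → evalP (sat F V w) φ ≡ sat F V w φ
  evalP-sat V w (var n) = refl
  evalP-sat V w ⊥'      = refl
  evalP-sat V w (φ ⇒ ψ) = cong₂ (λ x y → not x ∨ y) (evalP-sat V w φ) (evalP-sat V w ψ)
  evalP-sat V w (□ φ)   = refl
  evalP-sat V w (A φ)   = refl

  subst-sat : ∀ σ V w φ → sat F V w (subst σ φ) ≡ sat F (λ n u → sat F V u (σ n)) w φ
  subst-sat σ V w (var n) = refl
  subst-sat σ V w ⊥'      = refl
  subst-sat σ V w (φ ⇒ ψ) =
    cong₂ (λ x y → not x ∨ y) (subst-sat σ V w φ) (subst-sat σ V w ψ)
  subst-sat σ V w (□ φ) = every-cong λ u → cong (not (R w u) ∨_) (subst-sat σ V u φ)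
  subst-sat σ V w (A φ) = every-cong λ u → cong (not (E w u) ∨_) (subst-sat σ V u φ)

  sat-cong : ∀ {V V′ : Valuation} → (∀ n → V n ≗ V′ n) → ∀ w φ → sat F V w φ ≡ sat F V′ w φ
  sat-cong V≗V′ w (var n) = V≗V′ n w
  sat-cong V≗V′ w ⊥'      = refl
  sat-cong V≗V′ w (φ ⇒ ψ) =
    cong₂ (λ x y → not x ∨ y) (sat-cong V≗V′ w φ) (sat-cong V≗V′ w ψ)
  sat-cong V≗V′ w (□ φ) = every-cong λ u → cong (not (R w u) ∨_) (sat-cong V≗V′ u φ)
  sat-cong V≗V′ w (A φ) = every-cong λ u → cong (not (E w u) ∨_) (sat-cong V≗V′ u φ)

  MS4+-sound : ∀ {χ} → Commutes → ValidFm F χ → ValidLogic F (MS4+ χ)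
  MS4+-sound {χ} commutes χ-valid = valid
    where
    valid : ∀ φ → MS4+ χ φ → ValidFm F φ
    valid φ (taut tautology) V w = trans (sym (evalP-sat V w φ)) (tautology _)
    valid _ □K    = □K-valid
    valid _ □T    = □T-valid
    valid _ □4    = □4-valid
    valid _ AK    = AK-valid
    valid _ AT    = AT-valid
    valid _ A4    = A4-valid
    valid _ A5    = A5-valid
    valid _ left  = left-valid commutes
    valid _ extra = χ-valid
    valid _ (mp φ⇒ψ φ) V w = ⇒ᵇ-elim (valid _ φ⇒ψ V w) (valid _ φ V w)
    valid _ (usubst {φ} σ ⊢φ) V w = trans (subst-sat σ V w φ) (valid φ ⊢φ _ w)
    valid _ (nec□ {φ} ⊢φ) V w = Rules.□-intro V φ λ u _ → valid φ ⊢φ V u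
    valid _ (necA {φ} ⊢φ) V w = Rules.A-intro V φ λ u _ → valid φ ⊢φ V u

  valid₁? : Fm → Bool
  valid₁? φ = everyPredicate size λ P → every λ w → sat F (λ _ → P) w φ

  -- For a formula in p alone, subst (λ _ → p) φ is φ itself.
  valid₁?-sound : ∀ φ → valid₁? φ ≡ true → ValidFm F (subst (λ _ → p) φ)
  valid₁?-sound φ check V w =
    trans (subst-sat (λ _ → p) V w φ)
          (every-elim (everyPredicate-elim size valid-cong check (V 0)) w)
    where
    valid-cong : ∀ {P Q} → P ≗ Q →
                 every (λ w → sat F (λ _ → P) w φ) ≡ every (λ w → sat F (λ _ → Q) w φ)
    valid-cong P≗Q = every-cong λ w → sat-cong (λ _ → P≗Q) w φ

  refuted : ∀ {χ} (V : Valuation) w → sat F V w χ ≡ false → ¬ ValidLogic F (MS4+ χ)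
  refuted {χ} V w χ-false valid with trans (sym χ-false) (valid χ extra V w)
  ... | ()

ValidLogic-antitone : ∀ F {L L′ : Fm → Set} → (∀ φ → L φ → L′ φ) →
                      ValidLogic F L′ → ValidLogic F L
ValidLogic-antitone F L⊆L′ valid φ ⊢φ = valid φ (L⊆L′ φ ⊢φ)

open FrameSemantics using (Commutes; MS4+-sound; valid₁?-sound; refuted)

pattern a = zero
pattern b = suc zero
pattern c = suc (suc zero)

𝔎-commutes : Commutes 𝔎
𝔎-commutes a _ a _ _ = a , refl , refl
𝔎-commutes a _ b _ _ = a , refl , refl
𝔎-commutes b _ a _ _ = b , refl , refl
𝔎-commutes b _ b _ _ = b , refl , refl

ℌ-commutes : Commutes ℌ
ℌ-commutes a _ a _ _ = a , refl , refl
ℌ-commutes a _ b _ _ = b , refl , refl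
ℌ-commutes a _ c _ _ = c , refl , refl
ℌ-commutes b _ a _ _ = b , refl , refl
ℌ-commutes b _ b _ _ = b , refl , refl
ℌ-commutes b _ c _ _ = c , refl , refl
ℌ-commutes c a _ () _
ℌ-commutes c b _ () _
ℌ-commutes c c a _ ()
ℌ-commutes c c b _ _ = b , refl , refl
ℌ-commutes c c c _ _ = c , refl , refl

theorem5p4 : ((ValidLogic 𝔎 MGrz × ¬ ValidLogic 𝔎 LKur)
             × (ValidLogic ℌ LKur × ¬ ValidLogic ℌ MGrz))
             × (¬ (∀ φ → MGrz φ → LKur φ) × ¬ (∀ φ → LKur φ → MGrz φ))
theorem5p4 =
  ((𝔎⊨MGrz , 𝔎⊭LKur) , (ℌ⊨LKur , ℌ⊭MGrz)) ,
  (λ MGrz⊆LKur → ℌ⊭MGrz (ValidLogic-antitone ℌ MGrz⊆LKur ℌ⊨LKur)) ,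
  (λ LKur⊆MGrz → 𝔎⊭LKur (ValidLogic-antitone 𝔎 LKur⊆MGrz 𝔎⊨MGrz))
  where
  𝔎⊨MGrz : ValidLogic 𝔎 MGrz
  𝔎⊨MGrz = MS4+-sound 𝔎 𝔎-commutes (valid₁?-sound 𝔎 grz refl)

  𝔎⊭LKur : ¬ ValidLogic 𝔎 LKur
  𝔎⊭LKur = refuted 𝔎 (λ _ → false ∷ true ∷ []) a refl

  ℌ⊨LKur : ValidLogic ℌ LKur
  ℌ⊨LKur = MS4+-sound ℌ ℌ-commutes (valid₁?-sound ℌ kur refl)

  ℌ⊭MGrz : ¬ ValidLogic ℌ MGrz
  ℌ⊭MGrz = refuted ℌ (λ _ → false ∷ true ∷ false ∷ []) c refl
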